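{- For every integer $n \geq 5$, $\gamma_R(P(n,2)) \leq \left\lceil \frac{8n}{7} \right\rceil$.
   Context: For integers $n$ and $k$, the generalized Petersen graph $P(n,k)$ is the graph with vertex set $\{v_i, u_i : 0 \leq i \leq n-1\}$ and edge set $\{v_i v_{i+1}, v_i u_i, u_i u_{i+k} : 0 \leq i \leq n-1\}$, subscripts taken modulo $n$. A Roman domination function (RDF) on a graph $G$ is a function $f: V(G) \to \{0,1,2\}$ such that every vertex $u$ with $f(u)=0$ is adjacent to at least one vertex $v$ with $f(v)=2$. Its weight is $\sum_{u \in V(G)} f(u)$. The Roman domination number $\gamma_R(G)$ is the minimum weight of an RDF on $G$. -}

module Defs where

open import Data.Nat using (ℕ; zero; suc; _+_; _*_; _≤_; NonZero)
open import Data.Nat.DivMod using (_%_; _/_)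
open import Data.Fin using (Fin; toℕ)
open import Data.Bool using (Bool; true; false)
open import Data.Product using (_×_; _,_; Σ; ∃; ∃-syntax)
open import Data.Sum using (_⊎_)
open import Data.List using (List; map; allFin; cartesianProduct)
open import Data.Nat.ListAction using (sum)
open import Relation.Binary.PropositionalEquality using (_≡_)

-- Vertices of the generalized Petersen graph P(n,k):
-- (false , i) is the outer vertex v_i, (true , i) is the inner vertex u_i.
PVertex : ℕ → Set
PVertex n = Bool × Fin n

data PEdge (n k : ℕ) .{{_ : NonZero n}} : PVertex n → PVertex n → Set where
  outer : (i j : Fin n) → toℕ j ≡ (toℕ i + 1) % n → PEdge n k (false , i) (false , j)
  spoke : (i : Fin n) → PEdge n k (false , i) (true , i)
  inner : (i j : Fin n) → toℕ j ≡ (toℕ i + k) % n → PEdge n k (true , i) (true , j)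

PAdj : (n k : ℕ) .{{_ : NonZero n}} → PVertex n → PVertex n → Set
PAdj n k x y = PEdge n k x y ⊎ PEdge n k y x

allPVertices : (n : ℕ) → List (PVertex n)
allPVertices n = cartesianProduct (false Data.List.∷ true Data.List.∷ Data.List.[]) (allFin n)

IsRDF : (n k : ℕ) .{{_ : NonZero n}} → (PVertex n → Fin 3) → Set
IsRDF n k f = (x : PVertex n) → toℕ (f x) ≡ 0 →
  ∃[ y ] (PAdj n k x y × toℕ (f y) ≡ 2)

weight : (n : ℕ) → (PVertex n → Fin 3) → ℕ
weight n f = sum (map (λ x → toℕ (f x)) (allPVertices n))

RomanDomNumberAtMost : (n k : ℕ) .{{_ : NonZero n}} → ℕ → Set
RomanDomNumberAtMost n k m = ∃[ f ] (IsRDF n k f × weight n f ≤ m)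

ceilDiv : ℕ → (b : ℕ) .{{_ : NonZero b}} → ℕ
ceilDiv a (suc b) = (a + b) / suc b

-- Encode a labelling of P(n,2) as the cyclic word of its columns (f v_i , f u_i).  The
-- neighbours of v_i are u_i, v_(i±1) and those of u_i are v_i, u_(i±2), so whether the two
-- vertices of column i are Roman-dominated depends only on the five columns i-2, …, i+2: a
-- word gives a Roman dominating function as soon as all its cyclic windows of length five
-- pass a finite check.  The block (0,0)(1,0)(0,2)(0,2)(1,0)(0,0)(2,0) carries weight 8 on 7
-- columns.  Writing n = 7q + ℓ with 5 ≤ ℓ ≤ 11, the word made of q blocks followed by a
-- closing word of length ℓ and weight at most (8ℓ + 6)/7 has weight at most ⌈8n/7⌉.  A
-- window spans only five columns, so for q ≥ 1 the window check reduces, by evaluation, to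
-- the windows around the single junction between the last block and the closing word.

module Submission where

open import Defs
open import Data.Bool using (Bool; true; false; not; _∧_; _∨_; T)
open import Data.Bool.Properties using (T-∧; T-∨)
open import Data.Fin using (Fin; toℕ; #_)
open import Data.Fin.Patterns using (0F; 1F; 2F; 3F; 4F; 5F; 6F)
open import Data.Fin.Properties using (toℕ-fromℕ<; toℕ<n; toℕ≤pred[n]; toℕ-injective)
open import Data.List using (List; []; _∷_; _++_; length; map; take; drop; tabulate; allFin)
open import Data.List.Properties using (map-++; map-∘; map-tabulate; length-++; length-take; ++-identityʳ)
open import Data.Nat using (ℕ; zero; suc; _+_; _*_; _∸_; _⊓_; _≤_; _<_; _<?_; _≡ᵇ_; _≤ᵇ_; s≤s; NonZero)
open import Data.Nat.DivMod using (_%_; _/_; _mod_; _divMod_; result; %-distribˡ-+; m%n%n≡m%n; m<n⇒m%n≡m; [m+n]%n≡m%n; m*n/n≡m; /-monoˡ-≤)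
open import Data.Nat.ListAction using (sum)
open import Data.Nat.ListAction.Properties using (sum-++)
open import Data.Nat.Properties
open import Algebra.Properties.CommutativeSemigroup +-commutativeSemigroup using (interchange; xy∙z≈xz∙y)
open import Data.Nat.Tactic.RingSolver using (solve-∀)
open import Data.Product using (_×_; _,_; proj₁; proj₂; ∃-syntax)
open import Data.Sum as Sum using (_⊎_; inj₁; inj₂)
open import Function using (_∘_)
open import Function.Bundles using (module Equivalence)
open import Relation.Binary.PropositionalEquality
open import Relation.Nullary using (yes; no)

open Equivalence using (to)

[m%n+k]%n≡[m+k]%n : ∀ m k n .{{_ : NonZero n}} → (m % n + k) % n ≡ (m + k) % n
[m%n+k]%n≡[m+k]%n m k n = begin
  (m % n + k) % n          ≡⟨ %-distribˡ-+ (m % n) k n ⟩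
  (m % n % n + k % n) % n  ≡⟨ cong (λ a → (a + k % n) % n) (m%n%n≡m%n m n) ⟩
  (m % n + k % n) % n      ≡⟨ %-distribˡ-+ m k n ⟨
  (m + k) % n              ∎
  where open ≡-Reasoning

≤ceilDiv : ∀ {m a} b → m * suc b ≤ a + b → m ≤ ceilDiv a (suc b)
≤ceilDiv {m} {a} b m*[1+b]≤a+b = begin
  m                  ≡⟨ m*n/n≡m m (suc b) ⟨
  m * suc b / suc b  ≤⟨ /-monoˡ-≤ (suc b) m*[1+b]≤a+b ⟩
  (a + b) / suc b    ∎
  where open ≤-Reasoning

sum-map-+ : ∀ {A : Set} (f g : A → ℕ) xs →
  sum (map (λ x → f x + g x) xs) ≡ sum (map f xs) + sum (map g xs)
sum-map-+ f g [] = refl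
sum-map-+ f g (x ∷ xs) =
  trans (cong (f x + g x +_) (sum-map-+ f g xs)) (interchange (f x) (g x) _ _)

module _ {n} .{{_ : NonZero n}} where

  shift : ℕ → Fin n → Fin n
  shift k i = (k + toℕ i) mod n

  toℕ-shift-+ : ∀ k d i → toℕ (shift (k + d) i) ≡ (toℕ (shift k i) + d) % n
  toℕ-shift-+ k d i = begin
    toℕ (shift (k + d) i)          ≡⟨ toℕ-fromℕ< _ ⟩
    (k + d + toℕ i) % n            ≡⟨ cong (_% n) (xy∙z≈xz∙y k d (toℕ i)) ⟩
    (k + toℕ i + d) % n            ≡⟨ [m%n+k]%n≡[m+k]%n (k + toℕ i) d n ⟨
    ((k + toℕ i) % n + d) % n      ≡⟨ cong (λ a → (a + d) % n) (toℕ-fromℕ< _) ⟨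
    (toℕ (shift k i) + d) % n      ∎
    where open ≡-Reasoning

  shift-surjective : ∀ {k} → k ≤ n → ∀ i → ∃[ j ] shift k j ≡ i
  shift-surjective {k} k≤n i = j , toℕ-injective (begin
    toℕ (shift k j)                ≡⟨ toℕ-fromℕ< _ ⟩
    (k + toℕ j) % n                ≡⟨ cong (_% n) (+-comm k (toℕ j)) ⟩
    (toℕ j + k) % n                ≡⟨ cong (λ a → (a + k) % n) (toℕ-fromℕ< _) ⟩
    ((toℕ i + (n ∸ k)) % n + k) % n ≡⟨ [m%n+k]%n≡[m+k]%n (toℕ i + (n ∸ k)) k n ⟩
    (toℕ i + (n ∸ k) + k) % n      ≡⟨ cong (_% n) (trans (+-assoc (toℕ i) (n ∸ k) k) (cong (toℕ i +_) (m∸n+n≡m k≤n))) ⟩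
    (toℕ i + n) % n                ≡⟨ [m+n]%n≡m%n (toℕ i) n ⟩
    toℕ i % n                      ≡⟨ m<n⇒m%n≡m (toℕ<n i) ⟩
    toℕ i                          ∎)
    where
    open ≡-Reasoning
    j : Fin n
    j = (toℕ i + (n ∸ k)) mod n

Column : Set
Column = Fin 3 × Fin 3

-- Indices past the end of the word yield the junk column (0 , 0).
at : List Column → ℕ → Column
at []      _       = # 0 , # 0
at (c ∷ w) zero    = c
at (c ∷ w) (suc j) = at w j

at-++ˡ : ∀ w {v} j → j < length w → at (w ++ v) j ≡ at w j
at-++ˡ (c ∷ w) zero    _         = refl
at-++ˡ (c ∷ w) (suc j) (s≤s j<w) = at-++ˡ w j j<w

at-++ʳ : ∀ w {v} j → at (w ++ v) (length w + j) ≡ at v j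
at-++ʳ []      j = refl
at-++ʳ (c ∷ w) j = at-++ʳ w j

at-take : ∀ w {k j} → j < k → at (take k w) j ≡ at w j
at-take []      {suc k}         _         = refl
at-take (c ∷ w) {suc k} {zero}  _         = refl
at-take (c ∷ w) {suc k} {suc j} (s≤s j<k) = at-take w j<k

map-at-allFin : ∀ w → map (at w ∘ toℕ) (allFin (length w)) ≡ w
map-at-allFin w = trans (map-tabulate (λ i → i) (at w ∘ toℕ)) (tabulate-at w)
  where
  tabulate-at : ∀ w → tabulate {n = length w} (at w ∘ toℕ) ≡ w
  tabulate-at []      = refl
  tabulate-at (c ∷ w) = cong (c ∷_) (tabulate-at w)

isTwo : Fin 3 → Bool
isTwo x = toℕ x ≡ᵇ 2

defended : Fin 3 → Fin 3 → Fin 3 → Fin 3 → Bool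
defended x p q r = not (toℕ x ≡ᵇ 0) ∨ isTwo p ∨ isTwo q ∨ isTwo r

defended⇒neighbour≡2 : ∀ {x p q r} → T (defended x p q r) → toℕ x ≡ 0 →
  toℕ p ≡ 2 ⊎ toℕ q ≡ 2 ⊎ toℕ r ≡ 2
defended⇒neighbour≡2 {0F} {p} {q} {r} h _ =
  Sum.map (≡ᵇ⇒≡ (toℕ p) 2) (Sum.map (≡ᵇ⇒≡ (toℕ q) 2) (≡ᵇ⇒≡ (toℕ r) 2) ∘ to T-∨) (to T-∨ h)
defended⇒neighbour≡2 {Fin.suc _} _ ()

-- The outer neighbours of the middle column are b and d, its inner neighbours a and e.
windowGuarded : Column → Column → Column → Column → Column → Bool
windowGuarded a b (x , y) d e = defended x y (proj₁ b) (proj₁ d) ∧ defended y x (proj₂ a) (proj₂ e)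

guardedAround : (ℕ → Column) → ℕ → Bool
guardedAround c j = windowGuarded (c j) (c (1 + j)) (c (2 + j)) (c (3 + j)) (c (4 + j))

guardedAround-cong : ∀ {c c′} j → (∀ (k : Fin 5) → c (toℕ k + j) ≡ c′ (toℕ k + j)) →
  guardedAround c j ≡ guardedAround c′ j
guardedAround-cong j c≡c′
  rewrite c≡c′ (# 0) | c≡c′ (# 1) | c≡c′ (# 2) | c≡c′ (# 3) | c≡c′ (# 4) = refl

allWindowsGuarded : List Column → Bool
allWindowsGuarded (a ∷ w@(b ∷ c ∷ d ∷ e ∷ _)) = windowGuarded a b c d e ∧ allWindowsGuarded w
allWindowsGuarded _                           = true

allWindowsGuarded⇒guardedAround : ∀ w j → T (allWindowsGuarded w) → 5 + j ≤ length w →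
  T (guardedAround (at w) j)
allWindowsGuarded⇒guardedAround (a ∷ w@(_ ∷ _ ∷ _ ∷ _ ∷ _)) zero h _ = proj₁ (to T-∧ h)
allWindowsGuarded⇒guardedAround (a ∷ w@(_ ∷ _ ∷ _ ∷ _ ∷ _)) (suc j) h (s≤s 5+j≤w) =
  allWindowsGuarded⇒guardedAround w j (proj₂ (to T-∧ h)) 5+j≤w
allWindowsGuarded⇒guardedAround []                    _ _ ()
allWindowsGuarded⇒guardedAround (_ ∷ [])              _ _ (s≤s ())
allWindowsGuarded⇒guardedAround (_ ∷ _ ∷ [])          _ _ (s≤s (s≤s ()))
allWindowsGuarded⇒guardedAround (_ ∷ _ ∷ _ ∷ [])      _ _ (s≤s (s≤s (s≤s ())))
allWindowsGuarded⇒guardedAround (_ ∷ _ ∷ _ ∷ _ ∷ [])  _ _ (s≤s (s≤s (s≤s (s≤s ()))))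

cyclicallyGuarded : List Column → Bool
cyclicallyGuarded w = allWindowsGuarded (w ++ take 4 w)

labelling : ∀ {n} → List Column → PVertex n → Fin 3
labelling w (false , i) = proj₁ (at w (toℕ i))
labelling w (true  , i) = proj₂ (at w (toℕ i))

module _ {n} .{{_ : NonZero n}} (w : List Column) (|w|≡n : length w ≡ n) (4≤n : 4 ≤ n) where

  private
    unrolled : List Column
    unrolled = w ++ take 4 w

    cyclicAt : ℕ → Column
    cyclicAt p = at w (toℕ (p mod n))

    2≤n : 2 ≤ n
    2≤n = ≤-trans (m≤n+m 2 2) 4≤n

  length-unrolled : length unrolled ≡ 4 + n
  length-unrolled = begin
    length unrolled               ≡⟨ length-++ w ⟩
    length w + length (take 4 w)  ≡⟨ cong₂ _+_ |w|≡n (length-take 4 w) ⟩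
    n + (4 ⊓ length w)            ≡⟨ cong (n +_) (m≤n⇒m⊓n≡m (≤-trans 4≤n (≤-reflexive (sym |w|≡n)))) ⟩
    n + 4                         ≡⟨ +-comm n 4 ⟩
    4 + n                         ∎
    where open ≡-Reasoning

  at-unrolled : ∀ p → p < 4 + n → at unrolled p ≡ at w (p % n)
  at-unrolled p p<4+n with p <? n
  ... | yes p<n = begin
    at unrolled p         ≡⟨ at-++ˡ w p (subst (p <_) (sym |w|≡n) p<n) ⟩
    at w p                ≡⟨ cong (at w) (m<n⇒m%n≡m p<n) ⟨
    at w (p % n)          ∎
    where open ≡-Reasoning
  ... | no p≮n = begin
    at unrolled p                    ≡⟨ cong (at unrolled) (trans (sym n+t≡p) (cong (_+ t) (sym |w|≡n))) ⟩
    at unrolled (length w + t)       ≡⟨ at-++ʳ w t ⟩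
    at (take 4 w) t                  ≡⟨ at-take w t<4 ⟩
    at w t                           ≡⟨ cong (at w) t≡p%n ⟩
    at w (p % n)                     ∎
    where
    open ≡-Reasoning
    t : ℕ
    t = p ∸ n
    n+t≡p : n + t ≡ p
    n+t≡p = m+[n∸m]≡n (≮⇒≥ p≮n)
    t<4 : t < 4
    t<4 = +-cancelʳ-< n t 4 (subst (_< 4 + n) (trans (sym n+t≡p) (+-comm n t)) p<4+n)
    t≡p%n : t ≡ p % n
    t≡p%n = begin
      t            ≡⟨ m<n⇒m%n≡m (<-≤-trans t<4 4≤n) ⟨
      t % n        ≡⟨ [m+n]%n≡m%n t n ⟨
      (t + n) % n  ≡⟨ cong (_% n) (trans (+-comm t n) n+t≡p) ⟩
      p % n        ∎

  cyclicallyGuarded⇒guardedAround : T (cyclicallyGuarded w) → ∀ j → T (guardedAround cyclicAt (toℕ j))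
  cyclicallyGuarded⇒guardedAround guarded j = subst T (guardedAround-cong {at unrolled} {cyclicAt} (toℕ j) column≡)
    (allWindowsGuarded⇒guardedAround unrolled (toℕ j) guarded
      (subst (5 + toℕ j ≤_) (sym length-unrolled) (+-monoʳ-≤ 4 (toℕ<n j))))
    where
    column≡ : ∀ k → at unrolled (toℕ k + toℕ j) ≡ cyclicAt (toℕ k + toℕ j)
    column≡ k = trans (at-unrolled _ (+-mono-≤-< (toℕ≤pred[n] k) (toℕ<n j)))
                      (cong (at w) (sym (toℕ-fromℕ< _)))

  -- Column i is the middle of the window starting at column j, where shift 2 j ≡ i.
  cyclicallyGuarded⇒IsRDF : T (cyclicallyGuarded w) → IsRDF n 2 (labelling w)
  cyclicallyGuarded⇒IsRDF guarded (false , i) v≡0 with shift-surjective 2≤n i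
  ... | j , refl with defended⇒neighbour≡2 (proj₁ (to T-∧ (cyclicallyGuarded⇒guardedAround guarded j))) v≡0
  ... | inj₁ u≡2        = (true  , shift 2 j) , inj₁ (spoke _)                          , u≡2
  ... | inj₂ (inj₁ v≡2) = (false , shift 1 j) , inj₂ (outer _ _ (toℕ-shift-+ 1 1 j)) , v≡2
  ... | inj₂ (inj₂ v≡2) = (false , shift 3 j) , inj₁ (outer _ _ (toℕ-shift-+ 2 1 j)) , v≡2
  cyclicallyGuarded⇒IsRDF guarded (true , i) u≡0 with shift-surjective 2≤n i
  ... | j , refl with defended⇒neighbour≡2 (proj₂ (to T-∧ (cyclicallyGuarded⇒guardedAround guarded j))) u≡0
  ... | inj₁ v≡2        = (false , shift 2 j) , inj₂ (spoke _)                          , v≡2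
  ... | inj₂ (inj₁ u≡2) = (true  , shift 0 j) , inj₂ (inner _ _ (toℕ-shift-+ 0 2 j)) , u≡2
  ... | inj₂ (inj₂ u≡2) = (true  , shift 4 j) , inj₁ (inner _ _ (toℕ-shift-+ 2 2 j)) , u≡2

columnWeight : Column → ℕ
columnWeight (x , y) = toℕ x + toℕ y

wordWeight : List Column → ℕ
wordWeight w = sum (map columnWeight w)

weight≡sum-columns : ∀ n (f : PVertex n → Fin 3) →
  weight n f ≡ sum (map (λ i → toℕ (f (false , i)) + toℕ (f (true , i))) (allFin n))
weight≡sum-columns n f = begin
  sum (map h (vs ++ (us ++ [])))   ≡⟨ cong (sum ∘ map h ∘ (vs ++_)) (++-identityʳ us) ⟩
  sum (map h (vs ++ us))           ≡⟨ cong sum (map-++ h vs us) ⟩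
  sum (map h vs ++ map h us)       ≡⟨ sum-++ (map h vs) (map h us) ⟩
  sum (map h vs) + sum (map h us)  ≡⟨ cong₂ _+_ (cong sum (map-∘ (allFin n))) (cong sum (map-∘ (allFin n))) ⟨
  sum (map (h ∘ (false ,_)) (allFin n)) + sum (map (h ∘ (true ,_)) (allFin n))
                                   ≡⟨ sum-map-+ (h ∘ (false ,_)) (h ∘ (true ,_)) (allFin n) ⟨
  sum (map (λ i → h (false , i) + h (true , i)) (allFin n)) ∎
  where
  open ≡-Reasoning
  h : PVertex n → ℕ
  h = toℕ ∘ f
  vs us : List (PVertex n)
  vs = map (false ,_) (allFin n)
  us = map (true ,_) (allFin n)

weight-labelling : ∀ w {n} → length w ≡ n → weight n (labelling w) ≡ wordWeight w
weight-labelling w refl = begin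
  weight (length w) (labelling w)                                ≡⟨ weight≡sum-columns (length w) (labelling w) ⟩
  sum (map (columnWeight ∘ (at w ∘ toℕ)) (allFin (length w)))    ≡⟨ cong sum (map-∘ (allFin (length w))) ⟩
  sum (map columnWeight (map (at w ∘ toℕ) (allFin (length w))))  ≡⟨ cong (sum ∘ map columnWeight) (map-at-allFin w) ⟩
  wordWeight w                                                   ∎
  where open ≡-Reasoning

block : List Column
block = (# 0 , # 0) ∷ (# 1 , # 0) ∷ (# 0 , # 2) ∷ (# 0 , # 2) ∷ (# 1 , # 0) ∷ (# 0 , # 0) ∷ (# 2 , # 0) ∷ []

blocks : ℕ → List Column → List Column
blocks zero    w = w
blocks (suc q) w = block ++ blocks q w

length-blocks : ∀ q w → length (blocks q w) ≡ q * 7 + length w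
length-blocks zero    w = refl
length-blocks (suc q) w = cong (7 +_) (length-blocks q w)

wordWeight-blocks : ∀ q w → wordWeight (blocks q w) ≡ q * 8 + wordWeight w
wordWeight-blocks zero    w = refl
wordWeight-blocks (suc q) w = cong (8 +_) (wordWeight-blocks q w)

-- Both sides evaluate the windows lying inside the prefix drop 3 block ++ block away.
allWindowsGuarded-blocks : ∀ q w v →
  allWindowsGuarded (drop 3 block ++ blocks q w ++ v) ≡ allWindowsGuarded (drop 3 block ++ w ++ v)
allWindowsGuarded-blocks zero    w v = refl
allWindowsGuarded-blocks (suc q) w v = allWindowsGuarded-blocks q w v

record ClosingWord (ℓ : ℕ) : Set where
  field
    word               : List Column
    length-word        : length word ≡ ℓ
    guarded            : T (cyclicallyGuarded word)
    guardedAfterBlocks : T (allWindowsGuarded (drop 3 block ++ word ++ take 4 block))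
    light              : wordWeight word * 7 ≤ 8 * ℓ + 6

cyclicallyGuarded-blocks : ∀ {ℓ} (cw : ClosingWord ℓ) q →
  T (cyclicallyGuarded (blocks q (ClosingWord.word cw)))
cyclicallyGuarded-blocks cw zero    = ClosingWord.guarded cw
cyclicallyGuarded-blocks cw (suc q) =
  subst T (sym (allWindowsGuarded-blocks q word (take 4 block))) guardedAfterBlocks
  where open ClosingWord cw

closingWord-bound : ∀ {ℓ} → ClosingWord ℓ → ∀ q n .{{_ : NonZero n}} → 4 ≤ n → n ≡ q * 7 + ℓ →
  RomanDomNumberAtMost n 2 (ceilDiv (8 * n) 7)
closingWord-bound {ℓ} cw q n 4≤n refl =
  labelling w , cyclicallyGuarded⇒IsRDF w |w|≡n 4≤n (cyclicallyGuarded-blocks cw q) , ≤ceilDiv 6 weight*7≤8n+6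
  where
  open ClosingWord cw
  open ≤-Reasoning
  w : List Column
  w = blocks q word
  |w|≡n : length w ≡ q * 7 + ℓ
  |w|≡n = trans (length-blocks q word) (cong (q * 7 +_) length-word)
  expandˡ : ∀ q a → (q * 8 + a) * 7 ≡ q * 56 + a * 7
  expandˡ = solve-∀
  expandʳ : ∀ q ℓ → q * 56 + (8 * ℓ + 6) ≡ 8 * (q * 7 + ℓ) + 6
  expandʳ = solve-∀
  weight*7≤8n+6 : weight (q * 7 + ℓ) (labelling w) * 7 ≤ 8 * (q * 7 + ℓ) + 6
  weight*7≤8n+6 = begin
    weight (q * 7 + ℓ) (labelling w) * 7  ≡⟨ cong (_* 7) (trans (weight-labelling w |w|≡n) (wordWeight-blocks q word)) ⟩
    (q * 8 + wordWeight word) * 7         ≡⟨ expandˡ q (wordWeight word) ⟩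
    q * 56 + wordWeight word * 7          ≤⟨ +-monoʳ-≤ (q * 56) light ⟩
    q * 56 + (8 * ℓ + 6)                  ≡⟨ expandʳ q ℓ ⟩
    8 * (q * 7 + ℓ) + 6                   ∎

closingWordOf : (w : List Column) → T (cyclicallyGuarded w) →
  T (allWindowsGuarded (drop 3 block ++ w ++ take 4 block)) →
  T (wordWeight w * 7 ≤ᵇ 8 * length w + 6) → ClosingWord (length w)
closingWordOf w guarded guardedAfterBlocks light = record
  { word               = w
  ; length-word        = refl
  ; guarded            = guarded
  ; guardedAfterBlocks = guardedAfterBlocks
  ; light              = ≤ᵇ⇒≤ _ _ light
  }

word₅ word₆ : List Column
word₅ = (# 0 , # 0) ∷ (# 0 , # 2) ∷ (# 0 , # 2) ∷ (# 0 , # 0) ∷ (# 2 , # 0) ∷ []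
word₆ = (# 0 , # 0) ∷ (# 0 , # 2) ∷ (# 0 , # 2) ∷ (# 1 , # 0) ∷ (# 0 , # 0) ∷ (# 2 , # 0) ∷ []

closingWord : (r : Fin 7) → ClosingWord (5 + toℕ r)
closingWord 0F = closingWordOf word₅ _ _ _
closingWord 1F = closingWordOf word₆ _ _ _
closingWord 2F = closingWordOf block _ _ _
closingWord 3F = closingWordOf (block ++ (# 2 , # 0) ∷ []) _ _ _
closingWord 4F = closingWordOf (block ++ (# 0 , # 1) ∷ (# 2 , # 0) ∷ []) _ _ _
closingWord 5F = closingWordOf (block ++ (# 0 , # 1) ∷ (# 0 , # 1) ∷ (# 2 , # 0) ∷ []) _ _ _
closingWord 6F = closingWordOf (word₅ ++ word₆) _ _ _

lemma2p1 : (n : ℕ) .{{_ : NonZero n}} → 5 ≤ n →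
    RomanDomNumberAtMost n 2 (ceilDiv (8 * n) 7)
lemma2p1 n 5≤n with (n ∸ 5) divMod 7
... | result q r n∸5≡r+q*7 = closingWord-bound (closingWord r) q n (<⇒≤ 5≤n) n≡q*7+[5+r]
  where
  open ≡-Reasoning
  rearrange : ∀ r q → r + q * 7 + 5 ≡ q * 7 + (5 + r)
  rearrange = solve-∀
  n≡q*7+[5+r] : n ≡ q * 7 + (5 + toℕ r)
  n≡q*7+[5+r] = begin
    n                  ≡⟨ m∸n+n≡m 5≤n ⟨
    n ∸ 5 + 5          ≡⟨ cong (_+ 5) n∸5≡r+q*7 ⟩
    toℕ r + q * 7 + 5  ≡⟨ rearrange (toℕ r) q ⟩
    q * 7 + (5 + toℕ r) ∎
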